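{- Let $x_0=(y_0,m_0,d_0)\in G_0$ and let $r_2=\#\{z\in G_0: (y_0,3,0)\le z<x_0\}$ be its day of the year. Set $n_3=2141\cdot r_2+197913$, $q_3=n_3/2^{16}$ and $r_3=n_3\%2^{16}/2141$. Then $q_3=m_0$ and $r_3=d_0$.
   Context: For $n,\delta\in\mathbb{Z}$ with $\delta\neq0$, $n/\delta$ and $n\%\delta$ denote Euclidean quotient and remainder ($n=q\delta+s$, $0\le s<|\delta|$); $\cdot$, $/$, $\%$ have equal precedence and associate left to right. $\mathbb{Z}^3$ carries the lexicographic order. A year $y$ is a leap year if ($y\%4=0$ and $y\%100\ne0$) or $y\%400=0$. The Gregorian calendar is $G=\{(y,m,d)\in\mathbb{Z}^3: m\in\{1,\dots,12\},\ 1\le d\le L(y,m)\}$ where $L(y,m)=31$ for $m\in\{1,3,5,7,8,10,12\}$, $L(y,m)=30$ for $m\in\{4,6,9,11\}$, and $L(y,2)=29$ if $y$ is a leap year and $28$ otherwise. Let $P_1:\mathbb{Z}^3\to\mathbb{Z}^3$, $P_1(y,m,d)=(y-\mathbf 1_{\{m\le2\}},\ m+12\cdot\mathbf 1_{\{m\le2\}},\ d-1)$, where $\mathbf 1_{\{P\}}$ is $1$ if $P$ holds and $0$ otherwise. The computational calendar is $G_0=\{P_1(x): x\in G,\ P_1(x)\ge (0,3,0)\}$. -}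

module Defs where

open import Data.Integer using (ℤ; +_; -_; _+_; _-_; _*_; _/_; _%_; _<_; _≤_)
open import Data.Nat using (ℕ)
open import Data.Product using (_×_; _,_; Σ; ∃)
open import Data.Sum using (_⊎_)
open import Relation.Binary.PropositionalEquality using (_≡_; _≢_)
open import Relation.Nullary using (¬_)

Date : Set
Date = ℤ × ℤ × ℤ

_<ₗ_ : Date → Date → Set
(a₁ , a₂ , a₃) <ₗ (b₁ , b₂ , b₃) =
  (a₁ < b₁) ⊎ ((a₁ ≡ b₁) × ((a₂ < b₂) ⊎ ((a₂ ≡ b₂) × (a₃ < b₃))))

_≤ₗ_ : Date → Date → Set
a ≤ₗ b = (a <ₗ b) ⊎ (a ≡ b)

-- Leap year (Euclidean remainder; ℤ's _%_ in stdlib is Euclidean, valued in ℕ)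
IsLeap : ℤ → Set
IsLeap y = ((y % + 4 ≡ 0) × (y % + 100 ≢ 0)) ⊎ (y % + 400 ≡ 0)

MonthLength : ℤ → ℤ → ℤ → Set
MonthLength y m l =
    ((m ≡ + 1 ⊎ m ≡ + 3 ⊎ m ≡ + 5 ⊎ m ≡ + 7 ⊎ m ≡ + 8 ⊎ m ≡ + 10 ⊎ m ≡ + 12) × l ≡ + 31)
  ⊎ ((m ≡ + 4 ⊎ m ≡ + 6 ⊎ m ≡ + 9 ⊎ m ≡ + 11) × l ≡ + 30)
  ⊎ (m ≡ + 2 × IsLeap y × l ≡ + 29)
  ⊎ (m ≡ + 2 × ¬ IsLeap y × l ≡ + 28)

InG : Date → Set
InG (y , m , d) = (+ 1 ≤ m) × (m ≤ + 12) × (+ 1 ≤ d) ×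
                  Σ ℤ (λ l → MonthLength y m l × d ≤ l)

P₁ : Date → Date
P₁ (y , m , d) with m Data.Integer.≤? + 2
... | Relation.Nullary.yes _ = (y - + 1 , m + + 12 , d - + 1)
... | Relation.Nullary.no  _ = (y , m , d - + 1)

InG₀ : Date → Set
InG₀ z = Σ Date (λ x → InG x × P₁ x ≡ z × ((+ 0 , + 3 , + 0) ≤ₗ P₁ x))

{-# OPTIONS --safe #-}
module Submission where

-- An element of G₀ is (y , + i , + j) with 3 ≤ i ≤ 14 (March, …, February of the next Gregorian
-- year) and j below the length of month i, and every such triple with y ≥ 0 lies in G₀ except
-- February 29 of a common year. Hence the elements of G₀ from (y , 3 , 0) up to (y , a , b) are
-- the (y , i , j) with (i , j) lexicographically below (a , b) in a fixed table of a leap year: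
-- February 29 is the last entry of that table, so it never lies below a date. The day of the
-- year thus depends only on (a , b), and the formulas are checked by evaluation on all 366
-- entries of the table.

open import Defs
open import Data.Integer using (ℤ; +_; _+_; _*_; _/_; _%_)
open import Data.Nat using (ℕ)
open import Data.List using (List; length)
open import Data.List.Membership.Propositional using (_∈_)
open import Data.List.Relation.Unary.Unique.Propositional using (Unique)
open import Data.Product using (_×_; _,_; Σ)
open import Function.Bundles using (_⇔_)
open import Relation.Binary.PropositionalEquality using (_≡_)

open import Data.Empty using (⊥-elim)
import Data.Integer as ℤ
import Data.Integer.Properties as ℤ
open import Data.List using (map; filter; upTo; cartesianProduct)
open import Data.List.Membership.Propositional.Properties
  using (∈-map⁺; ∈-map⁻; ∈-filter⁺; ∈-filter⁻; ∈-upTo⁺; ∈-upTo⁻; ∈-cartesianProduct⁺; ∈-cartesianProduct⁻)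
open import Data.List.Properties using (length-map)
open import Data.List.Relation.Unary.All as All using (All)
import Data.List.Relation.Unary.Unique.Propositional.Properties as Unique
import Data.Nat as ℕ
open import Data.Nat using (zero; suc; z≤n; s≤s; _≤_; _<_; _≟_; _<?_; _≤?_)
open import Data.Nat.Properties using (<-≤-trans; <⇒≱; m≤n⇒m≤1+n; m≤n⇒m<n∨m≡n)
open import Data.Product.Relation.Binary.Lex.Strict using (×-Lex; ×-decidable)
open import Data.Sum using (_⊎_; inj₁; inj₂)
open import Function.Bundles using (mk⇔)
open import Relation.Binary.PropositionalEquality using (refl; sym; trans; cong; subst)
open import Relation.Nullary using (Dec; yes; no; ¬_)
open import Relation.Nullary.Decidable using (True; toWitness; _×-dec_; _⊎-dec_; ¬?)
open import Relation.Unary using (Pred; Decidable)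

-- Month lengths of a leap year, months numbered as in G₀ (3 = March, …, 14 = February).
monthLength₀ : ℕ → ℕ
monthLength₀ 3  = 31
monthLength₀ 4  = 30
monthLength₀ 5  = 31
monthLength₀ 6  = 30
monthLength₀ 7  = 31
monthLength₀ 8  = 31
monthLength₀ 9  = 30
monthLength₀ 10 = 31
monthLength₀ 11 = 30
monthLength₀ 12 = 31
monthLength₀ 13 = 31
monthLength₀ 14 = 29
monthLength₀ _  = 0

WithinMonth : Pred (ℕ × ℕ) _
WithinMonth (i , j) = j < monthLength₀ i

withinMonth? : Decidable WithinMonth
withinMonth? (i , j) = j <? monthLength₀ i

leapYear : List (ℕ × ℕ)
leapYear = filter withinMonth? (cartesianProduct (upTo 15) (upTo 31))

∈-leapYear⁺ : ∀ {i j} → j < monthLength₀ i →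
              {i<15 : True (i <? 15)} {l≤31 : True (monthLength₀ i ≤? 31)} → (i , j) ∈ leapYear
∈-leapYear⁺ j<l {i<15} {l≤31} =
  ∈-filter⁺ withinMonth?
    (∈-cartesianProduct⁺ (∈-upTo⁺ (toWitness i<15)) (∈-upTo⁺ (<-≤-trans j<l (toWitness l≤31))))
    j<l

∈-leapYear⁻ : ∀ {i j} → (i , j) ∈ leapYear → i < 15 × j < monthLength₀ i
∈-leapYear⁻ p with ∈-filter⁻ withinMonth? p
... | q , j<l with ∈-cartesianProduct⁻ (upTo 15) (upTo 31) q
... | i∈ , _ = ∈-upTo⁻ i∈ , j<l

3≤month : ∀ i {j} → j < monthLength₀ i → 3 ≤ i
3≤month (suc (suc (suc _))) _ = s≤s (s≤s (s≤s z≤n))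

data InLeapYear : ℤ → ℤ → Set where
  inLeapYear : ∀ {i j} → (i , j) ∈ leapYear → InLeapYear (+ i) (+ j)

shifted-inLeapYear : ∀ {w y m d : ℤ} {i e} → (w , + i , + suc e ℤ.- + 1) ≡ (y , m , d) →
                     (i , e) ∈ leapYear → InLeapYear m d
shifted-inLeapYear refl = inLeapYear

P₁-image : ∀ {x y m d} → InG x → P₁ x ≡ (y , m , d) → InLeapYear m d
P₁-image {_ , _ , _} (_ , _ , ℤ.+≤+ {n = suc _} (s≤s z≤n) , _ , length , ℤ.+≤+ e<l) eq with length
... | inj₁ (inj₁ refl , refl)                                   = shifted-inLeapYear eq (∈-leapYear⁺ e<l)
... | inj₁ (inj₂ (inj₁ refl) , refl)                            = shifted-inLeapYear eq (∈-leapYear⁺ e<l)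
... | inj₁ (inj₂ (inj₂ (inj₁ refl)) , refl)                     = shifted-inLeapYear eq (∈-leapYear⁺ e<l)
... | inj₁ (inj₂ (inj₂ (inj₂ (inj₁ refl))) , refl)              = shifted-inLeapYear eq (∈-leapYear⁺ e<l)
... | inj₁ (inj₂ (inj₂ (inj₂ (inj₂ (inj₁ refl)))) , refl)       = shifted-inLeapYear eq (∈-leapYear⁺ e<l)
... | inj₁ (inj₂ (inj₂ (inj₂ (inj₂ (inj₂ (inj₁ refl))))) , refl) = shifted-inLeapYear eq (∈-leapYear⁺ e<l)
... | inj₁ (inj₂ (inj₂ (inj₂ (inj₂ (inj₂ (inj₂ refl))))) , refl) = shifted-inLeapYear eq (∈-leapYear⁺ e<l)
... | inj₂ (inj₁ (inj₁ refl , refl))                            = shifted-inLeapYear eq (∈-leapYear⁺ e<l)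
... | inj₂ (inj₁ (inj₂ (inj₁ refl) , refl))                     = shifted-inLeapYear eq (∈-leapYear⁺ e<l)
... | inj₂ (inj₁ (inj₂ (inj₂ (inj₁ refl)) , refl))              = shifted-inLeapYear eq (∈-leapYear⁺ e<l)
... | inj₂ (inj₁ (inj₂ (inj₂ (inj₂ refl)) , refl))              = shifted-inLeapYear eq (∈-leapYear⁺ e<l)
... | inj₂ (inj₂ (inj₁ (refl , _ , refl)))                      = shifted-inLeapYear eq (∈-leapYear⁺ e<l)
... | inj₂ (inj₂ (inj₂ (refl , _ , refl)))                      = shifted-inLeapYear eq (∈-leapYear⁺ (m≤n⇒m≤1+n e<l))

InG-intro : ∀ y {k l e} → MonthLength y (+ k) (+ l) → e < l →
      {1≤k : True (1 ≤? k)} {k≤12 : True (k ≤? 12)} → InG (y , + k , + suc e)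
InG-intro y length e<l {1≤k} {k≤12} =
  ℤ.+≤+ (toWitness 1≤k) , ℤ.+≤+ (toWitness k≤12) , ℤ.+≤+ (s≤s z≤n) , _ , length , ℤ.+≤+ e<l

isLeap? : ∀ y → Dec (IsLeap y)
isLeap? y = ((y % + 4 ≟ 0) ×-dec ¬? (y % + 100 ≟ 0)) ⊎-dec (y % + 400 ≟ 0)

i+1-1≡i : ∀ i → i + + 1 ℤ.- + 1 ≡ i
i+1-1≡i i = trans (ℤ.+-assoc i (+ 1) (ℤ.- + 1)) (ℤ.+-identityʳ i)

-- (14 , 28) is February 29 of the Gregorian year y + 1.
P₁-preimage : ∀ y i j → j < monthLength₀ i → ((i , j) ≡ (14 , 28) → IsLeap (y + + 1)) →
              Σ Date λ x → InG x × P₁ x ≡ (y , + i , + j)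
P₁-preimage y 3  j j<l _ = (y , + 3 , + suc j) , InG-intro y (inj₁ (inj₂ (inj₁ refl) , refl)) j<l , refl
P₁-preimage y 4  j j<l _ = (y , + 4 , + suc j) , InG-intro y (inj₂ (inj₁ (inj₁ refl , refl))) j<l , refl
P₁-preimage y 5  j j<l _ = (y , + 5 , + suc j) , InG-intro y (inj₁ (inj₂ (inj₂ (inj₁ refl)) , refl)) j<l , refl
P₁-preimage y 6  j j<l _ = (y , + 6 , + suc j) , InG-intro y (inj₂ (inj₁ (inj₂ (inj₁ refl) , refl))) j<l , refl
P₁-preimage y 7  j j<l _ = (y , + 7 , + suc j) , InG-intro y (inj₁ (inj₂ (inj₂ (inj₂ (inj₁ refl))) , refl)) j<l , refl
P₁-preimage y 8  j j<l _ = (y , + 8 , + suc j) , InG-intro y (inj₁ (inj₂ (inj₂ (inj₂ (inj₂ (inj₁ refl)))) , refl)) j<l , refl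
P₁-preimage y 9  j j<l _ = (y , + 9 , + suc j) , InG-intro y (inj₂ (inj₁ (inj₂ (inj₂ (inj₁ refl)) , refl))) j<l , refl
P₁-preimage y 10 j j<l _ = (y , + 10 , + suc j) , InG-intro y (inj₁ (inj₂ (inj₂ (inj₂ (inj₂ (inj₂ (inj₁ refl))))) , refl)) j<l , refl
P₁-preimage y 11 j j<l _ = (y , + 11 , + suc j) , InG-intro y (inj₂ (inj₁ (inj₂ (inj₂ (inj₂ refl)) , refl))) j<l , refl
P₁-preimage y 12 j j<l _ = (y , + 12 , + suc j) , InG-intro y (inj₁ (inj₂ (inj₂ (inj₂ (inj₂ (inj₂ (inj₂ refl))))) , refl)) j<l , refl
P₁-preimage y 13 j j<l _ =
  (y + + 1 , + 1 , + suc j) , InG-intro (y + + 1) (inj₁ (inj₁ refl , refl)) j<l , cong (_, + 13 , + j) (i+1-1≡i y)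
P₁-preimage y 14 j j<l leapDay⇒leap with isLeap? (y + + 1) | m≤n⇒m<n∨m≡n j<l
... | yes leap | _ =
  (y + + 1 , + 2 , + suc j) , InG-intro (y + + 1) (inj₂ (inj₂ (inj₁ (refl , leap , refl)))) j<l , cong (_, + 14 , + j) (i+1-1≡i y)
... | no common | inj₁ (s≤s j<28) =
  (y + + 1 , + 2 , + suc j) , InG-intro (y + + 1) (inj₂ (inj₂ (inj₂ (refl , common , refl)))) j<28 , cong (_, + 14 , + j) (i+1-1≡i y)
... | no common | inj₂ refl = ⊥-elim (common (leapDay⇒leap refl))

yearStart≤ₗ : ∀ y {i j} → 3 ≤ i → (y , + 3 , + 0) ≤ₗ (y , + i , + j)
yearStart≤ₗ y {j = j} 3≤i with m≤n⇒m<n∨m≡n 3≤i | j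
... | inj₁ 3<i  | _     = inj₁ (inj₂ (refl , inj₁ (ℤ.+<+ 3<i)))
... | inj₂ refl | zero  = inj₂ refl
... | inj₂ refl | suc _ = inj₁ (inj₂ (refl , inj₂ (refl , ℤ.+<+ (s≤s z≤n))))

origin≤ₗ : ∀ {y i j} → + 0 ℤ.≤ y → 3 ≤ i → (+ 0 , + 3 , + 0) ≤ₗ (y , + i , + j)
origin≤ₗ {+ zero}  _ 3≤i = yearStart≤ₗ (+ 0) 3≤i
origin≤ₗ {+ suc _} _ _   = inj₁ (inj₁ (ℤ.+<+ (s≤s z≤n)))

InG₀-intro : ∀ {y i j} → + 0 ℤ.≤ y → j < monthLength₀ i → ((i , j) ≡ (14 , 28) → IsLeap (y + + 1)) →
             InG₀ (y , + i , + j)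
InG₀-intro {y} {i} {j} 0≤y j<l leapDay⇒leap with P₁-preimage y i j j<l leapDay⇒leap
... | x , x∈G , eq = x , x∈G , eq , subst ((+ 0 , + 3 , + 0) ≤ₗ_) (sym eq) (origin≤ₗ 0≤y (3≤month i j<l))

InG₀⇒0≤year : ∀ {y m d} → InG₀ (y , m , d) → + 0 ℤ.≤ y
InG₀⇒0≤year (_ , _ , eq , origin≤P₁x) with subst ((+ 0 , + 3 , + 0) ≤ₗ_) eq origin≤P₁x
... | inj₁ (inj₁ 0<y)       = ℤ.<⇒≤ 0<y
... | inj₁ (inj₂ (refl , _)) = ℤ.+≤+ z≤n
... | inj₂ refl             = ℤ.+≤+ z≤n

InG₀⇒inLeapYear : ∀ {y m d} → InG₀ (y , m , d) → InLeapYear m d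
InG₀⇒inLeapYear (_ , x∈G , eq , _) = P₁-image x∈G eq

_≺_ : ℕ × ℕ → ℕ × ℕ → Set
_≺_ = ×-Lex _≡_ _<_ _<_

_≺?_ : ∀ p q → Dec (p ≺ q)
_≺?_ = ×-decidable _≟_ _<?_ _<?_

≺-leapDay-last : ∀ {a b} → (a , b) ∈ leapYear → ¬ (14 , 28) ≺ (a , b)
≺-leapDay-last p∈ leapDay≺p with ∈-leapYear⁻ p∈ | leapDay≺p
... | a<15 , _    | inj₁ 14<a         = <⇒≱ a<15 14<a
... | _    , b<29 | inj₂ (refl , 28<b) = <⇒≱ b<29 28<b

daysBefore : ℕ × ℕ → List (ℕ × ℕ)
daysBefore p = filter (_≺? p) leapYear

datesBefore : ℤ → ℕ × ℕ → List Date
datesBefore y p = map (λ (i , j) → y , + i , + j) (daysBefore p)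

sameYear : ∀ {y y′ s₂ s₃ t₂ t₃ u₂ u₃} → (y , s₂ , s₃) ≤ₗ (y′ , t₂ , t₃) → (y′ , t₂ , t₃) <ₗ (y , u₂ , u₃) → y′ ≡ y
sameYear (inj₁ (inj₂ (refl , _))) _                 = refl
sameYear (inj₂ refl)             _                 = refl
sameYear (inj₁ (inj₁ y<y′))      (inj₁ y′<y)       = ⊥-elim (ℤ.<-asym y<y′ y′<y)
sameYear (inj₁ (inj₁ y<y′))      (inj₂ (refl , _)) = ⊥-elim (ℤ.<-irrefl refl y<y′)

<ₗ⇒≺ : ∀ {y i j a b} → (y , + i , + j) <ₗ (y , + a , + b) → (i , j) ≺ (a , b)
<ₗ⇒≺ (inj₁ y<y)                          = ⊥-elim (ℤ.<-irrefl refl y<y)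
<ₗ⇒≺ (inj₂ (_ , inj₁ (ℤ.+<+ i<a)))        = inj₁ i<a
<ₗ⇒≺ (inj₂ (_ , inj₂ (refl , ℤ.+<+ j<b))) = inj₂ (refl , j<b)

≺⇒<ₗ : ∀ {y i j a b} → (i , j) ≺ (a , b) → (y , + i , + j) <ₗ (y , + a , + b)
≺⇒<ₗ (inj₁ i<a)         = inj₂ (refl , inj₁ (ℤ.+<+ i<a))
≺⇒<ₗ (inj₂ (refl , j<b)) = inj₂ (refl , inj₂ (refl , ℤ.+<+ j<b))

∈-datesBefore⁻ : ∀ {y a b z} → + 0 ℤ.≤ y → (a , b) ∈ leapYear → z ∈ datesBefore y (a , b) →
                 InG₀ z × (y , + 3 , + 0) ≤ₗ z × z <ₗ (y , + a , + b)
∈-datesBefore⁻ {y} 0≤y ab∈ z∈ with ∈-map⁻ _ z∈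
... | (i , j) , ij∈ , refl with ∈-filter⁻ (_≺? _) ij∈
... | ij∈leapYear , ij≺ab with ∈-leapYear⁻ ij∈leapYear
... | _ , j<l =
  InG₀-intro 0≤y j<l (λ { refl → ⊥-elim (≺-leapDay-last ab∈ ij≺ab) }) ,
  yearStart≤ₗ y (3≤month i j<l) ,
  ≺⇒<ₗ ij≺ab

∈-datesBefore⁺ : ∀ {y a b z} → InG₀ z × (y , + 3 , + 0) ≤ₗ z × z <ₗ (y , + a , + b) → z ∈ datesBefore y (a , b)
∈-datesBefore⁺ {z = _ , _ , _} (z∈G₀ , start≤z , z<ab) with InG₀⇒inLeapYear z∈G₀ | sameYear start≤z z<ab
... | inLeapYear ij∈ | refl = ∈-map⁺ _ (∈-filter⁺ (_≺? _) ij∈ (<ₗ⇒≺ z<ab))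

leapYear-unique : Unique leapYear
leapYear-unique = Unique.filter⁺ withinMonth? (Unique.cartesianProduct⁺ (Unique.upTo⁺ 15) (Unique.upTo⁺ 31))

datesBefore-unique : ∀ y p → Unique (datesBefore y p)
datesBefore-unique y p = Unique.map⁺ (λ { {_ , _} {_ , _} refl → refl }) (Unique.filter⁺ (_≺? p) leapYear-unique)

n₃ : ℕ → ℤ
n₃ r₂ = + 2141 * + r₂ + + 197913

q₃ : ℕ → ℤ
q₃ r₂ = n₃ r₂ / + 65536

r₃ : ℕ → ℕ
r₃ r₂ = n₃ r₂ % + 65536 ℕ./ 2141

dayOfYear : ℕ × ℕ → ℕ
dayOfYear p = length (daysBefore p)

Recovers : Pred (ℕ × ℕ) _
Recovers (a , b) = q₃ (dayOfYear (a , b)) ≡ + a × + r₃ (dayOfYear (a , b)) ≡ + b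

recovers? : Decidable Recovers
recovers? (a , b) = (q₃ (dayOfYear (a , b)) ℤ.≟ + a) ×-dec (+ r₃ (dayOfYear (a , b)) ℤ.≟ + b)

leapYear-recovers : All Recovers leapYear
leapYear-recovers = toWitness {a? = All.all? recovers? leapYear} _

corollary4 : (y₀ m₀ d₀ : ℤ) → InG₀ (y₀ , m₀ , d₀) →
    Σ (List Date) (λ zs →
      Unique zs ×
      ((z : Date) → (z ∈ zs) ⇔ (InG₀ z × ((y₀ , + 3 , + 0) ≤ₗ z) × (z <ₗ (y₀ , m₀ , d₀)))) ×
      ((+ 2141 * + (length zs) + + 197913) / + 65536 ≡ m₀ ×
       + ((((+ 2141 * + (length zs) + + 197913) % + 65536)) Data.Nat./ 2141) ≡ d₀))
corollary4 y₀ m₀ d₀ x₀∈G₀ with InG₀⇒inLeapYear x₀∈G₀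
... | inLeapYear {a} {b} ab∈ =
  datesBefore y₀ (a , b) ,
  datesBefore-unique y₀ (a , b) ,
  (λ _ → mk⇔ (∈-datesBefore⁻ (InG₀⇒0≤year x₀∈G₀) ab∈) ∈-datesBefore⁺) ,
  subst (λ r₂ → q₃ r₂ ≡ + a × + r₃ r₂ ≡ + b)
        (sym (length-map _ (daysBefore (a , b))))
        (All.lookup leapYear-recovers ab∈)
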